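{- For all $u,v\in F_2$, $\mathrm{Pal}(uv)=\mathrm{Pal}(u)\,R_u(\mathrm{Pal}(v))$.
   Context: $F_2$ is the free group on $a,b$. $w\mapsto R_w$ is the group homomorphism $F_2\to\mathrm{Aut}(F_2)$ with $R_a(a)=a$, $R_a(b)=ba$, $R_b(a)=ab$, $R_b(b)=b$. The palindromization map $\mathrm{Pal}:F_2\to F_2$ is defined by $\mathrm{Pal}(w)=b^{ -1}a^{ -1}R_w(ab)$. -}

module Defs where

open import Data.Bool using (Bool; true; false; not; if_then_else_; _∧_)
open import Data.List using (List; []; _∷_; _++_; reverse; map; concatMap; foldr)
open import Data.Product using (_×_; _,_)
open import Function using (_∘_; id)
open import Relation.Binary.PropositionalEquality using (_≡_)

data Gen : Set where
  a b : Gen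

-- A letter is a generator together with an exponent sign: (g , true) = g, (g , false) = g⁻¹
Letter : Set
Letter = Gen × Bool

-- Elements of F₂ are represented by (not necessarily reduced) words; two words
-- represent the same group element iff they have the same free reduction.
Word : Set
Word = List Letter

_==ᴳ_ : Gen → Gen → Bool
a ==ᴳ a = true
b ==ᴳ b = true
_ ==ᴳ _ = false

_==ᴮ_ : Bool → Bool → Bool
true ==ᴮ true = true
false ==ᴮ false = true
_ ==ᴮ _ = false

inverseLetters : Letter → Letter → Bool
inverseLetters (g , s) (h , t) = (g ==ᴳ h) ∧ not (s ==ᴮ t)

consRed : Letter → Word → Word
consRed x [] = x ∷ []
consRed x (y ∷ ys) = if inverseLetters x y then ys else x ∷ y ∷ ys

reduce : Word → Word
reduce = foldr consRed []

infix 4 _≈_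
_≈_ : Word → Word → Set
u ≈ v = reduce u ≡ reduce v

-- group operations on representatives: product is concatenation
gen : Gen → Word
gen g = (g , true) ∷ []

invLetter : Letter → Letter
invLetter (g , s) = (g , not s)

inv : Word → Word
inv w = reverse (map invLetter w)

substitute : (Gen → Word) → Word → Word
substitute φ = concatMap img
  where
  img : Letter → Word
  img (g , true) = φ g
  img (g , false) = inv (φ g)

-- R_a : a ↦ a, b ↦ ba ;  R_b : a ↦ ab, b ↦ b  and their inverses
-- R_a⁻¹ : a ↦ a, b ↦ ba⁻¹ ;  R_b⁻¹ : a ↦ ab⁻¹, b ↦ b
RLetterImg : Letter → Gen → Word
RLetterImg (a , true)  a = gen a
RLetterImg (a , true)  b = (b , true) ∷ (a , true) ∷ []
RLetterImg (a , false) a = gen a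
RLetterImg (a , false) b = (b , true) ∷ (a , false) ∷ []
RLetterImg (b , true)  a = (a , true) ∷ (b , true) ∷ []
RLetterImg (b , true)  b = gen b
RLetterImg (b , false) a = (a , true) ∷ (b , false) ∷ []
RLetterImg (b , false) b = gen b

RLetter : Letter → Word → Word
RLetter x = substitute (RLetterImg x)

R : Word → Word → Word
R w = foldr (λ x f → RLetter x ∘ f) id w

Pal : Word → Word
Pal w = (b , false) ∷ (a , false) ∷ R w ((a , true) ∷ (b , true) ∷ [])

-- Write ab for the word a·b.  By definition Pal(w) = (ab)⁻¹ R_w(ab), so
--   Pal(u) R_u(Pal(v)) = (ab)⁻¹ R_u(ab) R_u((ab)⁻¹) R_u(R_v(ab)).
-- Since R_u is an endomorphism, R_u((ab)⁻¹) = R_u(ab)⁻¹, the middle factor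
-- R_u(ab) R_u(ab)⁻¹ cancels, and R_u ∘ R_v = R_{uv} gives Pal(uv).
module Submission where

open import Defs
open import Data.List using (_++_)
open import Data.List using ([]; _∷_; reverse; map; foldr)
open import Data.List.Properties
  using (map-++; concatMap-++; unfold-reverse; reverse-++; ++-assoc; ++-identityʳ)
open import Data.Bool using (true; false; not)
open import Data.Product using (_×_; _,_)
open import Data.Unit using (⊤; tt)
open import Relation.Binary.PropositionalEquality

inv-∷ : ∀ x w → inv (x ∷ w) ≡ inv w ++ (invLetter x ∷ [])
inv-∷ x w = unfold-reverse (invLetter x) (map invLetter w)

inv-++ : ∀ x y → inv (x ++ y) ≡ inv y ++ inv x
inv-++ x y = trans (cong reverse (map-++ invLetter x y))
                   (reverse-++ (map invLetter x) (map invLetter y))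

invLetter-involutive : ∀ x → invLetter (invLetter x) ≡ x
invLetter-involutive (g , true)  = refl
invLetter-involutive (g , false) = refl

inv-involutive : ∀ w → inv (inv w) ≡ w
inv-involutive [] = refl
inv-involutive (x ∷ w) = begin
  inv (inv (x ∷ w))                    ≡⟨ cong inv (inv-∷ x w) ⟩
  inv (inv w ++ (invLetter x ∷ []))    ≡⟨ inv-++ (inv w) _ ⟩
  invLetter (invLetter x) ∷ inv (inv w) ≡⟨ cong₂ _∷_ (invLetter-involutive x) (inv-involutive w) ⟩
  x ∷ w                                ∎
  where open ≡-Reasoning

substitute-++ : ∀ φ x y → substitute φ (x ++ y) ≡ substitute φ x ++ substitute φ y
substitute-++ φ x y = concatMap-++ _ x y

substitute-invLetter : ∀ φ x →
  substitute φ (invLetter x ∷ []) ≡ inv (substitute φ (x ∷ []))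
substitute-invLetter φ (g , true) =
  trans (++-identityʳ _) (cong inv (sym (++-identityʳ (φ g))))
substitute-invLetter φ (g , false) =
  trans (++-identityʳ _)
        (trans (sym (inv-involutive (φ g)))
               (cong inv (sym (++-identityʳ (inv (φ g))))))

substitute-inv : ∀ φ w → substitute φ (inv w) ≡ inv (substitute φ w)
substitute-inv φ [] = refl
substitute-inv φ (x ∷ w) = begin
  substitute φ (inv (x ∷ w))                    ≡⟨ cong (substitute φ) (inv-∷ x w) ⟩
  substitute φ (inv w ++ (invLetter x ∷ []))    ≡⟨ substitute-++ φ (inv w) _ ⟩
  substitute φ (inv w) ++ substitute φ (invLetter x ∷ [])
    ≡⟨ cong₂ _++_ (substitute-inv φ w) (substitute-invLetter φ x) ⟩
  inv (substitute φ w) ++ inv (substitute φ (x ∷ []))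
    ≡⟨ sym (inv-++ (substitute φ (x ∷ [])) (substitute φ w)) ⟩
  inv (substitute φ (x ∷ []) ++ substitute φ w) ≡⟨ cong inv (sym (substitute-++ φ (x ∷ []) w)) ⟩
  inv (substitute φ (x ∷ w))                    ∎
  where open ≡-Reasoning

R-++ : ∀ u x y → R u (x ++ y) ≡ R u x ++ R u y
R-++ [] x y = refl
R-++ (c ∷ u) x y =
  trans (cong (RLetter c) (R-++ u x y)) (substitute-++ (RLetterImg c) (R u x) (R u y))

R-inv : ∀ u w → R u (inv w) ≡ inv (R u w)
R-inv [] w = refl
R-inv (c ∷ u) w = trans (cong (RLetter c) (R-inv u w)) (substitute-inv (RLetterImg c) (R u w))

R-compose : ∀ u v w → R (u ++ v) w ≡ R u (R v w)
R-compose [] v w = refl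
R-compose (c ∷ u) v w = cong (RLetter c) (R-compose u v w)

Reduced : Word → Set
Reduced [] = ⊤
Reduced (y ∷ []) = ⊤
Reduced (y ∷ z ∷ zs) = (inverseLetters y z ≡ false) × Reduced (z ∷ zs)

Reduced-tail : ∀ y ys → Reduced (y ∷ ys) → Reduced ys
Reduced-tail y [] _ = tt
Reduced-tail y (z ∷ zs) (_ , r) = r

consRed-Reduced : ∀ x r → Reduced r → Reduced (consRed x r)
consRed-Reduced x [] _ = tt
consRed-Reduced x (y ∷ ys) r with inverseLetters x y in eq
... | true  = Reduced-tail y ys r
... | false = eq , r

reduce-Reduced : ∀ w → Reduced (reduce w)
reduce-Reduced [] = tt
reduce-Reduced (x ∷ w) = consRed-Reduced x (reduce w) (reduce-Reduced w)

inverseLetters-invLetter : ∀ x → inverseLetters x (invLetter x) ≡ true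
inverseLetters-invLetter (a , true)  = refl
inverseLetters-invLetter (a , false) = refl
inverseLetters-invLetter (b , true)  = refl
inverseLetters-invLetter (b , false) = refl

oppositeSigns : ∀ s t → not (s ==ᴮ t) ≡ true → t ≡ not s
oppositeSigns true  false _ = refl
oppositeSigns false true  _ = refl

inverseLetters-unique : ∀ x y → inverseLetters x y ≡ true → y ≡ invLetter x
inverseLetters-unique (a , s) (a , t) p = cong (a ,_) (oppositeSigns s t p)
inverseLetters-unique (b , s) (b , t) p = cong (b ,_) (oppositeSigns s t p)
inverseLetters-unique (a , s) (b , t) ()
inverseLetters-unique (b , s) (a , t) ()

-- On a reduced word, pushing x⁻¹ and then x is the identity.  When x⁻¹
-- cancels the head of r, that head is x, and x cannot cancel the next
-- letter because r is reduced.
consRed-cancel : ∀ x r → Reduced r → consRed x (consRed (invLetter x) r) ≡ r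
consRed-cancel x [] _ rewrite inverseLetters-invLetter x = refl
consRed-cancel x (y ∷ ys) r with inverseLetters (invLetter x) y in eq
... | false rewrite inverseLetters-invLetter x = refl
... | true with trans (inverseLetters-unique (invLetter x) y eq) (invLetter-involutive x)
consRed-cancel x (.x ∷ [])     _       | true | refl = refl
consRed-cancel x (.x ∷ z ∷ zs) (p , _) | true | refl rewrite p = refl

reduce-++ : ∀ p y → reduce (p ++ y) ≡ foldr consRed (reduce y) p
reduce-++ [] y = refl
reduce-++ (c ∷ p) y = cong (consRed c) (reduce-++ p y)

≈-prefix : ∀ p {y z} → y ≈ z → p ++ y ≈ p ++ z
≈-prefix p {y} {z} y≈z = begin
  reduce (p ++ y)            ≡⟨ reduce-++ p y ⟩
  foldr consRed (reduce y) p ≡⟨ cong (λ r → foldr consRed r p) y≈z ⟩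
  foldr consRed (reduce z) p ≡⟨ sym (reduce-++ p z) ⟩
  reduce (p ++ z)            ∎
  where open ≡-Reasoning

cancel-inverse : ∀ w z → w ++ (inv w ++ z) ≈ z
cancel-inverse [] z = refl
cancel-inverse (x ∷ w) z = begin
  consRed x (reduce (w ++ (inv (x ∷ w) ++ z)))
    ≡⟨ cong (λ t → consRed x (reduce (w ++ (t ++ z)))) (inv-∷ x w) ⟩
  consRed x (reduce (w ++ ((inv w ++ (invLetter x ∷ [])) ++ z)))
    ≡⟨ cong (λ t → consRed x (reduce (w ++ t))) (++-assoc (inv w) _ z) ⟩
  consRed x (reduce (w ++ (inv w ++ (invLetter x ∷ z))))
    ≡⟨ cong (consRed x) (cancel-inverse w (invLetter x ∷ z)) ⟩
  consRed x (consRed (invLetter x) (reduce z))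
    ≡⟨ consRed-cancel x (reduce z) (reduce-Reduced z) ⟩
  reduce z ∎
  where open ≡-Reasoning

ab : Word
ab = (a , true) ∷ (b , true) ∷ []

-- Pal(w) = (ab)⁻¹ R_w(ab) holds definitionally, as inv ab computes to b⁻¹a⁻¹.
proposition3p3 : (u v : Word) → Pal (u ++ v) ≈ Pal u ++ R u (Pal v)
proposition3p3 u v =
  sym (≈-prefix (inv ab) {R u ab ++ R u (Pal v)} {R (u ++ v) ab} (begin
  reduce (R u ab ++ R u (inv ab ++ R v ab))
    ≡⟨ cong (λ t → reduce (R u ab ++ t)) (R-++ u (inv ab) (R v ab)) ⟩
  reduce (R u ab ++ (R u (inv ab) ++ R u (R v ab)))
    ≡⟨ cong (λ t → reduce (R u ab ++ (t ++ R u (R v ab)))) (R-inv u ab) ⟩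
  reduce (R u ab ++ (inv (R u ab) ++ R u (R v ab)))
    ≡⟨ cancel-inverse (R u ab) (R u (R v ab)) ⟩
  reduce (R u (R v ab))
    ≡⟨ cong reduce (sym (R-compose u v ab)) ⟩
  reduce (R (u ++ v) ab) ∎))
  where open ≡-Reasoning
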